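{- Let $b$ be an integer with $2\le b<\infty$ and let $X$ be an irrational base-$b$ word. Then the set $\{\sigma^k(X):k\in\mathbb{N}\}$ of shifts of $X$ has infinitely many limit points. In particular, if $\mathrm{ot}(X)$ is an ordinal, then $\mathrm{ot}(X)\succeq\omega^2$.
   Context: A word is an infinite sequence $W=w_0w_1w_2\cdots$ with $w_k\in\mathbb{N}$; it is a base-$b$ word if $0\le w_k<b$ for all $k$. Words are ordered lexicographically: $W<V$ if, for $i$ the least index with $w_i\ne v_i$, we have $w_i<v_i$. The distance between distinct words $W,V$ is $1/2^i$ with $i$ the least index where they differ; limit points are taken with respect to this metric. The shift map is $\sigma(w_0w_1w_2\cdots)=w_1w_2w_3\cdots$. $\mathrm{ot}(W)$ denotes the order type of the linearly ordered set $\{\sigma^k(W):k\in\mathbb{N}\}$. A word $W$ is irrational if $\sigma^j(W)\ne\sigma^k(W)$ for all $j\ne k$. Order types are compared with $\preceq$: $\beta\preceq\gamma$ if type $\beta$ order-embeds into type $\gamma$ (the usual $\le$ for ordinals); "$\mathrm{ot}(X)$ is an ordinal" means the set of shifts is well-ordered. -}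

module Defs where

open import Data.Nat using (ℕ; zero; suc; _<_)
open import Data.Product using (Σ; _×_; _,_; ∃; ∃-syntax)
open import Data.Sum using (_⊎_)
open import Relation.Binary.PropositionalEquality using (_≡_; _≢_)
open import Relation.Nullary using (¬_)
open import Induction.WellFounded using (WellFounded)

Word : Set
Word = ℕ → ℕ

IsBaseWord : ℕ → Word → Set
IsBaseWord b W = ∀ k → W k < b

_≈w_ : Word → Word → Set
W ≈w V = ∀ i → W i ≡ V i

σ : Word → Word
σ W n = W (suc n)

σ^ : ℕ → Word → Word
σ^ zero    W = W
σ^ (suc k) W = σ (σ^ k W)

_<lex_ : Word → Word → Set
W <lex V = ∃[ i ] ((∀ j → j < i → W j ≡ V j) × W i < V i)

Irrational : Word → Set
Irrational W = ∀ j k → j ≢ k → ¬ (σ^ j W ≈w σ^ k W)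

-- W and V agree on indices 0..n (i.e. W = V or d(W,V) < 1/2^n).
AgreeUpTo : ℕ → Word → Word → Set
AgreeUpTo n W V = ∀ i → i < suc n → W i ≡ V i

IsShiftLimitPoint : Word → Word → Set
IsShiftLimitPoint X V = ∀ n → ∃[ k ] (¬ (σ^ k X ≈w V) × AgreeUpTo n (σ^ k X) V)

_≺[_]_ : ℕ → Word → ℕ → Set
j ≺[ X ] k = σ^ j X <lex σ^ k X

-- ot(X) is an ordinal: the set of shifts is well-ordered by <lex.
OtIsOrdinal : Word → Set
OtIsOrdinal X = WellFounded (λ j k → j ≺[ X ] k)

-- Strict lexicographic order on ℕ × ℕ (order type ω²).
_<ω²_ : ℕ × ℕ → ℕ × ℕ → Set
(a , b) <ω² (c , d) = a < c ⊎ (a ≡ c × b < d)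

OmegaSqEmbeds : Word → Set
OmegaSqEmbeds X = Σ (ℕ × ℕ → ℕ) λ f → ∀ p q → p <ω² q → f p ≺[ X ] f q

{-# OPTIONS --safe #-}
module Submission where

-- Shifts of X are base-b words, so by compactness every infinite set of shifts clusters at some
-- word, and the cluster points of the shifts form a shift-invariant set. If there were only finitely
-- many, separated at depth m, then eventually every shift σ^ k X would be m-close to a cluster point
-- P k, and separation forces σ (P k) = P (k + 1); hence σ^ k X = P k eventually, and as P takes
-- finitely many values X would be eventually periodic.
-- If the shifts are well-ordered, so are the cluster points (a shift lies between any two of them),
-- which gives cluster points V 0 < V 1 < ⋯. Infinitely many shifts lie between V a and V (a + 1),
-- each such block contains an increasing ω-sequence of shifts, and the blocks together embed ω².

open import Defs
open import Data.Nat using (ℕ; zero; suc; _+_; _≤_; _<_; _⊔_; _≤′_; ≤′-refl; ≤′-step; z≤n; s≤s)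
open import Data.Nat.Properties
open import Data.Nat.Induction using (<-wellFounded)
open import Data.Product using (Σ; _×_; _,_; proj₁; proj₂; ∃-syntax)
open import Data.Sum using (_⊎_; inj₁; inj₂)
open import Data.Empty using (⊥-elim)
open import Data.Unit using (⊤; tt)
open import Data.List using (List; []; _∷_; lookup)
open import Data.List.Relation.Unary.All using (All; []; _∷_)
open import Data.List.Relation.Unary.All.Properties using (¬Any⇒All¬)
open import Data.List.Relation.Unary.Any using (index)
open import Data.List.Relation.Unary.Any.Properties using (lookup-index)
open import Data.Fin using (Fin; toℕ; fromℕ<)
open import Data.Fin.Properties using (pigeonhole; toℕ-fromℕ<)
open import Function using (_∘_; case_of_)
open import Relation.Nullary using (¬_; yes; no)
open import Relation.Binary.PropositionalEquality
open import Relation.Binary.Definitions using (tri<; tri≈; tri>)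
import Relation.Binary.Construct.On as On
open import Induction.WellFounded using (WellFounded; Acc; acc; module Subrelation)
open import Level using (0ℓ)
open import Axiom.ExcludedMiddle using (ExcludedMiddle)
open import Axiom.DoubleNegationElimination using (em⇒dne)

≈w-sym : ∀ {W V} → W ≈w V → V ≈w W
≈w-sym e i = sym (e i)

≈w-trans : ∀ {W V U} → W ≈w V → V ≈w U → W ≈w U
≈w-trans e f i = trans (e i) (f i)

σ^-+ : ∀ j N W → σ^ j (σ^ N W) ≡ σ^ (j + N) W
σ^-+ zero    N W = refl
σ^-+ (suc j) N W = cong σ (σ^-+ j N W)

shift-base : ∀ {b X} k → IsBaseWord b X → IsBaseWord b (σ^ k X)
shift-base zero    base = base
shift-base (suc k) base i = shift-base k base (suc i)

agree-mono : ∀ {m n W V} → m ≤ n → AgreeUpTo n W V → AgreeUpTo m W V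
agree-mono m≤n a i i<sm = a i (≤-trans i<sm (s≤s m≤n))

agree-σ : ∀ {n W V} → AgreeUpTo (suc n) W V → AgreeUpTo n (σ W) (σ V)
agree-σ a i i<sn = a (suc i) (s≤s i<sn)

agree-≈wʳ : ∀ {n W V U} → AgreeUpTo n W V → V ≈w U → AgreeUpTo n W U
agree-≈wʳ a e i i<sn = trans (a i i<sn) (e i)

-- σ^ j Y (suc i) is definitionally σ^ (suc j) Y i, so induction on i walks along P.
shifts-tracking : ∀ (Y : Word) (P : ℕ → Word) → (∀ j → σ (P j) ≈w P (suc j)) →
                  (∀ j → σ^ j Y 0 ≡ P j 0) → ∀ j → σ^ j Y ≈w P j
shifts-tracking Y P step first j zero    = first j
shifts-tracking Y P step first j (suc i) =
  trans (shifts-tracking Y P step first (suc j) i) (sym (step j i))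

<lex-trans : ∀ {W V U} → W <lex V → V <lex U → W <lex U
<lex-trans {W} {U = U} (i , ai , li) (j , aj , lj) with <-cmp i j
... | tri< i<j _ _ =
  i , (λ t t<i → trans (ai t t<i) (aj t (<-trans t<i i<j))) , subst (W i <_) (aj i i<j) li
... | tri≈ _ refl _ =
  i , (λ t t<i → trans (ai t t<i) (aj t t<i)) , <-trans li lj
... | tri> _ _ j<i =
  j , (λ t t<j → trans (ai t (<-trans t<j j<i)) (aj t t<j)) , subst (_< U j) (sym (ai j j<i)) lj

<lex-respˡ-≈w : ∀ {W W' V} → W ≈w W' → W <lex V → W' <lex V
<lex-respˡ-≈w {V = V} e (i , a , l) = i , (λ t t<i → trans (sym (e t)) (a t t<i)) , subst (_< V i) (e i) l

<lex-respʳ-≈w : ∀ {W V V'} → V ≈w V' → W <lex V → W <lex V'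
<lex-respʳ-≈w {W} e (i , a , l) = i , (λ t t<i → trans (a t t<i) (e t)) , subst (W i <_) (e i) l

<lex-agreeˡ : ∀ {V U W} (l : V <lex U) → AgreeUpTo (proj₁ l) W V → W <lex U
<lex-agreeˡ {U = U} (p , ap , lp) a =
  p , (λ t t<p → trans (a t (<-trans t<p (n<1+n p))) (ap t t<p)) , subst (_< U p) (sym (a p (n<1+n p))) lp

<lex-agreeʳ : ∀ {V U W} (l : V <lex U) → AgreeUpTo (proj₁ l) W U → V <lex W
<lex-agreeʳ {V} (p , ap , lp) a =
  p , (λ t t<p → trans (ap t t<p) (sym (a t (<-trans t<p (n<1+n p))))) , subst (V p <_) (sym (a p (n<1+n p))) lp

<lex-increasing : ∀ (s : ℕ → Word) → (∀ n → s n <lex s (suc n)) →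
                  ∀ {W m n} → m ≤ n → W <lex s m → W <lex s n
<lex-increasing s inc m≤n = go (≤⇒≤′ m≤n)
  where
  go : ∀ {W m n} → m ≤′ n → W <lex s m → W <lex s n
  go ≤′-refl        l = l
  go (≤′-step m≤′n) l = <lex-trans (go m≤′n l) (inc _)

Eventually : (ℕ → Set) → Set
Eventually S = ∃[ N ] (∀ k → N ≤ k → S k)

Infinite : (ℕ → Set) → Set
Infinite S = ∀ N → ∃[ k ] (N ≤ k × S k)

eventually-∩ : ∀ {S T} → Eventually S → Eventually T → Eventually (λ k → S k × T k)
eventually-∩ (N , s) (M , t) =
  N ⊔ M , λ k le → s k (≤-trans (m≤m⊔n N M) le) , t k (≤-trans (m≤n⊔m N M) le)

eventually-all : ∀ {L} {S : Fin L → ℕ → Set} → (∀ i → Eventually (S i)) →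
                 Eventually (λ k → ∀ i → S i k)
eventually-all {zero}  ev = 0 , λ _ _ ()
eventually-all {suc L} ev with eventually-∩ (ev Fin.zero) (eventually-all (ev ∘ Fin.suc))
... | N , both = N , λ { k le Fin.zero → proj₁ (both k le) ; k le (Fin.suc i) → proj₂ (both k le) i }

IsClusterPoint : (ℕ → Word) → Word → Set
IsClusterPoint f V = ∀ n N → ∃[ k ] (N ≤ k × AgreeUpTo n (f k) V)

IsClusterPointOn : (ℕ → Set) → (ℕ → Word) → Word → Set
IsClusterPointOn S f V = ∀ n N → ∃[ k ] (N ≤ k × S k × AgreeUpTo n (f k) V)

cluster-point-on⇒cluster-point : ∀ {S f V} → IsClusterPointOn S f V → IsClusterPoint f V
cluster-point-on⇒cluster-point c n N = let k , le , _ , a = c n N in k , le , a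

shifts : Word → ℕ → Word
shifts X k = σ^ k X

cluster-point-≈w : ∀ {f V U} → V ≈w U → IsClusterPoint f V → IsClusterPoint f U
cluster-point-≈w e c n N = let k , le , a = c n N in k , le , agree-≈wʳ a e

cluster-point-σ : ∀ {X V} → IsClusterPoint (shifts X) V → IsClusterPoint (shifts X) (σ V)
cluster-point-σ c n N = let k , le , a = c (suc n) N in suc k , m≤n⇒m≤1+n le , agree-σ a

InfinitelyMany : (Word → Set) → Set
InfinitelyMany T = ∀ (Ws : List Word) → ∃[ V ] (T V × All (λ W → ¬ (V ≈w W)) Ws)

InfinitelyMany-mono : ∀ {P Q} → (∀ V → P V → Q V) → InfinitelyMany P → InfinitelyMany Q
InfinitelyMany-mono P⊆Q inf Ws = let V , pV , avoids = inf Ws in V , P⊆Q V pV , avoids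

_<lex₁_ : ∀ {T : Word → Set} → Σ Word T → Σ Word T → Set
U <lex₁ V = proj₁ U <lex proj₁ V

WellOrdered : (Word → Set) → Set
WellOrdered T = WellFounded (_<lex₁_ {T})

wellOrdered-⊆ : ∀ {P T} → (∀ V → P V → T V) → WellOrdered T → WellOrdered P
wellOrdered-⊆ P⊆T = On.wellFounded (λ (V , p) → V , P⊆T V p)

IsShift : Word → Word → Set
IsShift X W = ∃[ k ] (W ≈w σ^ k X)

shifts-wellOrdered : ∀ {X} → OtIsOrdinal X → WellOrdered (IsShift X)
shifts-wellOrdered wf =
  Subrelation.wellFounded (λ { {_ , _ , e} {_ , _ , e'} l → <lex-respʳ-≈w e' (<lex-respˡ-≈w e l) })
    (On.wellFounded (λ (_ , k , _) → k) wf)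

module Classical (lem : ExcludedMiddle 0ℓ) where

  dne : {P : Set} → ¬ ¬ P → P
  dne = em⇒dne lem

  wf-minimal : ∀ {A : Set} {_<_ : A → A → Set} → WellFounded _<_ → (P : A → Set) → ∀ {x} → P x →
               ∃[ m ] (P m × (∀ y → P y → ¬ y < m))
  wf-minimal {_<_ = _<_} wf P {x} px with lem {∃[ m ] (P m × (∀ y → P y → ¬ y < m))}
  ... | yes minimal = minimal
  ... | no none     = ⊥-elim (no-element x (wf x) px)
    where
    no-element : ∀ z → Acc _<_ z → ¬ P z
    no-element z (acc rs) pz = none (z , pz , λ y py y<z → no-element y (rs y<z) py)

  ≉⇒first-difference : ∀ {W V} → ¬ (W ≈w V) → ∃[ i ] ((∀ j → j < i → W j ≡ V j) × W i ≢ V i)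
  ≉⇒first-difference {W} {V} W≉V =
    let i , d , minimal = wf-minimal <-wellFounded (λ i → W i ≢ V i) (proj₂ differs)
    in  i , (λ j j<i → dne λ d' → minimal j d' j<i) , d
    where
    differs : ∃[ i ] W i ≢ V i
    differs = dne λ agree → W≉V λ i → dne λ d → agree (i , d)

  <lex-trichotomy : ∀ W V → W <lex V ⊎ W ≈w V ⊎ V <lex W
  <lex-trichotomy W V with lem {W ≈w V}
  ... | yes W≈V = inj₂ (inj₁ W≈V)
  ... | no W≉V with ≉⇒first-difference W≉V
  ...   | i , agree , d with <-cmp (W i) (V i)
  ...     | tri< lt _ _ = inj₁ (i , agree , lt)
  ...     | tri≈ _ eq _ = ⊥-elim (d eq)
  ...     | tri> _ _ gt = inj₂ (inj₂ (i , (λ j j<i → sym (agree j j<i)) , gt))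

  ¬infinite⇒eventually-¬ : ∀ {S} → ¬ Infinite S → Eventually (λ k → ¬ S k)
  ¬infinite⇒eventually-¬ fin = dne λ never → fin λ N → dne λ none →
    never (N , λ k le sk → none (k , le , sk))

  infinite-pigeonhole : ∀ {b T} {g : ℕ → ℕ} → Infinite T → (∀ k → g k < b) →
                        ∃[ c ] Infinite (λ k → T k × g k ≡ c)
  infinite-pigeonhole {T = T} {g} infT g<b = dne λ none →
    let N , rare = eventually-all {S = λ c k → ¬ (T k × g k ≡ toℕ c)}
                     (λ c → ¬infinite⇒eventually-¬ λ inf → none (toℕ c , inf))
        k , le , tk = infT N
    in  rare k le (fromℕ< (g<b k)) (tk , sym (toℕ-fromℕ< (g<b k)))

  bolzano-weierstrass : ∀ {b} (f : ℕ → Word) → (∀ k → IsBaseWord b (f k)) → ∀ {S} → Infinite S →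
                        ∃[ V ] IsClusterPointOn S f V
  bolzano-weierstrass f bounded {S} infS = V , close
    where
    letter : ∀ n (T : Σ (ℕ → Set) Infinite) → ∃[ c ] Infinite (λ k → proj₁ T k × f k n ≡ c)
    letter n (T , infT) = infinite-pigeonhole infT (λ k → bounded k n)

    V : Word
    stage : ℕ → Σ (ℕ → Set) Infinite

    V n = proj₁ (letter n (stage n))

    stage zero    = S , infS
    stage (suc n) = (λ k → proj₁ (stage n) k × f k n ≡ V n) , proj₂ (letter n (stage n))

    stage-spec : ∀ n k → proj₁ (stage n) k → S k × (∀ i → i < n → f k i ≡ V i)
    stage-spec zero    k sk             = sk , λ _ ()
    stage-spec (suc n) k (tk , fkn≡Vn) with stage-spec n k tk
    ... | sk , prefix = sk , λ i i<1+n → case m<1+n⇒m<n∨m≡n i<1+n of λ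
      { (inj₁ i<n)  → prefix i i<n
      ; (inj₂ refl) → fkn≡Vn }

    close : IsClusterPointOn S f V
    close n N with proj₂ (stage (suc n)) N
    ... | k , le , tk = k , le , proj₁ (stage-spec (suc n) k tk) , proj₂ (stage-spec (suc n) k tk)

  eventually-separated : ∀ W V → Eventually (λ m → AgreeUpTo m W V → W ≈w V)
  eventually-separated W V with lem {W ≈w V}
  ... | yes W≈V = 0 , λ _ _ _ → W≈V
  ... | no W≉V with ≉⇒first-difference W≉V
  ...   | i , _ , d = i , λ m i≤m agree → ⊥-elim (d (agree i (s≤s i≤m)))

  separation-depth : ∀ {L} (ws : Fin L → Word) →
                     ∃[ m ] (∀ i j → AgreeUpTo m (ws i) (ws j) → ws i ≈w ws j)
  separation-depth ws =
    let m , separated = eventually-all λ i → eventually-all λ j → eventually-separated (ws i) (ws j)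
    in  m , separated m ≤-refl

  finitely-many-cluster-points⇒eventually-periodic :
    ∀ {b L X} → IsBaseWord b X → (ws : Fin L → Word) →
    (∀ V → IsClusterPoint (shifts X) V → ∃[ i ] (V ≈w ws i)) →
    ∃[ j ] ∃[ k ] (j < k × σ^ j X ≈w σ^ k X)
  finitely-many-cluster-points⇒eventually-periodic {L = L} {X} base ws covers =
    let a , a' , a<a' , same = pigeonhole (n<1+n L) (ι ∘ toℕ)
    in  toℕ a + N , toℕ a' + N , +-monoˡ-< N a<a' ,
        subst₂ _≈w_ (σ^-+ (toℕ a) N X) (σ^-+ (toℕ a') N X)
          (≈w-trans (tracking (toℕ a))
            (≈w-trans (λ t → cong (λ i → ws i t) same) (≈w-sym (tracking (toℕ a')))))
    where
    m : ℕ
    m = proj₁ (separation-depth ws)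

    NearClusterPoint : Word → Set
    NearClusterPoint W = ∃[ i ] (IsClusterPoint (shifts X) (ws i) × AgreeUpTo (suc m) W (ws i))

    eventually-near : Eventually (NearClusterPoint ∘ shifts X)
    eventually-near with lem {Infinite (λ k → ¬ NearClusterPoint (σ^ k X))}
    ... | no finite = let N , near = ¬infinite⇒eventually-¬ finite in N , λ k le → dne (near k le)
    ... | yes infinite =
      let V , cVS     = bolzano-weierstrass (shifts X) (λ k → shift-base k base) infinite
          cV          = cluster-point-on⇒cluster-point cVS
          i , V≈wsi   = covers V cV
          _ , _ , far , agree = cVS (suc m) 0
      in  ⊥-elim (far (i , cluster-point-≈w V≈wsi cV , agree-≈wʳ agree V≈wsi))

    N : ℕ
    N = proj₁ eventually-near

    Y : Word
    Y = σ^ N X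

    near : ∀ j → NearClusterPoint (σ^ j Y)
    near j rewrite σ^-+ j N X = proj₂ eventually-near (j + N) (m≤n+m N j)

    ι : ℕ → Fin L
    ι j = proj₁ (near j)

    P : ℕ → Word
    P j = ws (ι j)

    near-agree : ∀ j → AgreeUpTo (suc m) (σ^ j Y) (P j)
    near-agree j = proj₂ (proj₂ (near j))

    -- σ (P j) is a cluster point agreeing with P (suc j) up to m, so separation identifies them.
    step : ∀ j → σ (P j) ≈w P (suc j)
    step j with covers (σ (P j)) (cluster-point-σ (proj₁ (proj₂ (near j))))
    ... | i , e = ≈w-trans e (proj₂ (separation-depth ws) i (ι (suc j)) agree)
      where
      agree : AgreeUpTo m (ws i) (P (suc j))
      agree t t≤m = begin
        ws i t           ≡⟨ sym (e t) ⟩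
        P j (suc t)      ≡⟨ sym (near-agree j (suc t) (s≤s t≤m)) ⟩
        σ^ (suc j) Y t   ≡⟨ near-agree (suc j) t (m≤n⇒m≤1+n t≤m) ⟩
        P (suc j) t      ∎
        where open ≡-Reasoning

    tracking : ∀ j → σ^ j Y ≈w P j
    tracking = shifts-tracking Y P step (λ j → near-agree j 0 (s≤s z≤n))

  eventually-≉ : ∀ {X} → Irrational X → ∀ V → Eventually (λ k → ¬ (σ^ k X ≈w V))
  eventually-≉ {X} irr V with lem {∃[ k₀ ] (σ^ k₀ X ≈w V)}
  ... | no none         = 0 , λ k _ e → none (k , e)
  ... | yes (k₀ , k₀≈V) = suc k₀ , λ k k₀<k k≈V → irr k₀ k (<⇒≢ k₀<k) (≈w-trans k₀≈V (≈w-sym k≈V))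

  eventually-avoids : ∀ {X} → Irrational X → ∀ Ws → Eventually (λ k → All (λ W → ¬ (σ^ k X ≈w W)) Ws)
  eventually-avoids irr []       = 0 , λ _ _ → []
  eventually-avoids irr (W ∷ Ws) =
    let N , avoids = eventually-∩ (eventually-≉ irr W) (eventually-avoids irr Ws)
    in  N , λ k le → proj₁ (avoids k le) ∷ proj₂ (avoids k le)

  cluster-point⇒limit-point : ∀ {X V} → Irrational X → IsClusterPoint (shifts X) V → IsShiftLimitPoint X V
  cluster-point⇒limit-point irr cV n with eventually-≉ irr _
  ... | N , ≉V = let k , le , agree = cV n N in k , ≉V k le , agree

  infinitely-many-cluster-points : ∀ {b X} → IsBaseWord b X → Irrational X →
                                   InfinitelyMany (IsClusterPoint (shifts X))
  infinitely-many-cluster-points {X = X} base irr Ws = dne λ none →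
    let j , k , j<k , periodic = finitely-many-cluster-points⇒eventually-periodic base (lookup Ws) (covers none)
    in  irr j k (<⇒≢ j<k) periodic
    where
    covers : ¬ (∃[ V ] (IsClusterPoint (shifts X) V × All (λ W → ¬ (V ≈w W)) Ws)) →
             ∀ V → IsClusterPoint (shifts X) V → ∃[ i ] (V ≈w lookup Ws i)
    covers none V cV =
      let V∈Ws = dne λ V∉Ws → none (V , cV , ¬Any⇒All¬ Ws V∉Ws) in index V∈Ws , lookup-index V∈Ws

  least : ∀ {T} → WellOrdered T → ∀ {V} → T V → ∃[ M ] (T M × (∀ U → T U → ¬ (U <lex M)))
  least wo {V} tV =
    let (M , tM) , _ , minimal = wf-minimal wo (λ _ → ⊤) {V , tV} tt
    in  M , tM , λ U tU → minimal (U , tU) tt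

  least-with-infinitely-many-above : ∀ {T} → WellOrdered T → InfinitelyMany T →
                                     ∃[ M ] (T M × InfinitelyMany (λ V → T V × M <lex V))
  least-with-infinitely-many-above wo inf with least wo (proj₁ (proj₂ (inf [])))
  ... | M , tM , minimal = M , tM , above
    where
    above : InfinitelyMany _
    above Ws with inf (M ∷ Ws)
    ... | V , tV , V≉M ∷ avoids with <lex-trichotomy V M
    ...   | inj₁ V<M        = ⊥-elim (minimal V tV V<M)
    ...   | inj₂ (inj₁ V≈M) = ⊥-elim (V≉M V≈M)
    ...   | inj₂ (inj₂ M<V) = V , (tV , M<V) , avoids

  increasing-sequence : ∀ {T} → WellOrdered T → InfinitelyMany T →
                        ∃[ s ] ((∀ n → T (s n)) × (∀ n → s n <lex s (suc n)))
  increasing-sequence {T} wo inf = proj₁ ∘ state , proj₁ ∘ proj₂ ∘ state , proj₂ ∘ next ∘ state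
    where
    State : Set
    State = Σ Word λ W → T W × InfinitelyMany (λ V → T V × W <lex V)

    next : (st : State) → Σ State λ st' → proj₁ st <lex proj₁ st'
    next (W , _ , above) with least-with-infinitely-many-above (wellOrdered-⊆ (λ _ → proj₁) wo) above
    ... | M , (tM , W<M) , aboveM =
      (M , tM , InfinitelyMany-mono (λ _ ((tV , _) , M<V) → tV , M<V) aboveM) , W<M

    state : ℕ → State
    state zero    = least-with-infinitely-many-above wo inf
    state (suc n) = proj₁ (next (state n))

  module _ {X : Word} (irr : Irrational X) (wf : OtIsOrdinal X) where

    -- The least shift above V differs from V first at some p; a shift agreeing with V up to p
    -- and above V would lie strictly below it.
    close-shifts-not-above : ∀ V → ∃[ n ] (∀ k → AgreeUpTo n (σ^ k X) V → ¬ (V <lex σ^ k X))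
    close-shifts-not-above V with lem {∃[ k ] (V <lex σ^ k X)}
    ... | no none       = 0 , λ k _ V<k → none (k , V<k)
    ... | yes (k , V<k) with wf-minimal wf (λ k → V <lex σ^ k X) {k} V<k
    ...   | k₀ , V<k₀ , minimal = proj₁ V<k₀ , λ k agree V<k → minimal k V<k (<lex-agreeˡ V<k₀ agree)

    shifts-between : ∀ {V' V} → V' <lex V → IsClusterPoint (shifts X) V →
                     Infinite (λ k → V' <lex σ^ k X × σ^ k X <lex V)
    shifts-between {V = V} V'<V cV N with close-shifts-not-above V | eventually-≉ irr V
    ... | n , not-above | N₀ , ≉V with cV (proj₁ V'<V ⊔ n) (N ⊔ N₀)
    ...   | k , le , agree with <lex-trichotomy (σ^ k X) V
    ...     | inj₁ k<V        =
      k , ≤-trans (m≤m⊔n N N₀) le , <lex-agreeʳ V'<V (agree-mono (m≤m⊔n _ n) agree) , k<V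
    ...     | inj₂ (inj₁ k≈V) = ⊥-elim (≉V k (≤-trans (m≤n⊔m N N₀) le) k≈V)
    ...     | inj₂ (inj₂ V<k) = ⊥-elim (not-above k (agree-mono (m≤n⊔m (proj₁ V'<V) n) agree) V<k)

    cluster-points-wellOrdered : WellOrdered (IsClusterPoint (shifts X))
    cluster-points-wellOrdered (V , cV) = acc λ {(V' , cV')} V'<V →
      let k , _ , V'<k , _ = shifts-between V'<V cV 0 in below-shift {k} (wf k) cV' V'<k
      where
      below-shift : ∀ {k} → Acc (λ j k → j ≺[ X ] k) k → ∀ {V} (cV : IsClusterPoint (shifts X) V) →
                    V <lex σ^ k X → Acc _<lex₁_ (V , cV)
      below-shift (acc rs) cV V<k = acc λ {(V' , cV')} V'<V →
        let k' , _ , V'<k' , k'<V = shifts-between V'<V cV 0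
        in  below-shift {k'} (rs (<lex-trans k'<V V<k)) cV' V'<k'

    ω²-embeds : ∀ {b} → IsBaseWord b X → OmegaSqEmbeds X
    ω²-embeds base = position , embeds
      where
      limits : ∃[ s ] ((∀ n → IsClusterPoint (shifts X) (s n)) × (∀ n → s n <lex s (suc n)))
      limits = increasing-sequence cluster-points-wellOrdered (infinitely-many-cluster-points base irr)

      V : ℕ → Word
      V = proj₁ limits

      V-cluster : ∀ a → IsClusterPoint (shifts X) (V a)
      V-cluster = proj₁ (proj₂ limits)

      V-increasing : ∀ a → V a <lex V (suc a)
      V-increasing = proj₂ (proj₂ limits)

      Block : ℕ → Word → Set
      Block a W = IsShift X W × V a <lex W × W <lex V (suc a)

      block-infinite : ∀ a → InfinitelyMany (Block a)
      block-infinite a Ws =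
        let N , avoids = eventually-avoids irr Ws
            k , le , between = shifts-between (V-increasing a) (V-cluster (suc a)) N
        in  σ^ k X , ((k , λ _ → refl) , between) , avoids k le

      block-sequence : ∀ a → ∃[ t ] ((∀ c → Block a (t c)) × (∀ c → t c <lex t (suc c)))
      block-sequence a =
        increasing-sequence (wellOrdered-⊆ (λ _ → proj₁) (shifts-wellOrdered wf)) (block-infinite a)

      t : ℕ × ℕ → Word
      t (a , c) = proj₁ (block-sequence a) c

      in-block : ∀ a c → Block a (t (a , c))
      in-block a = proj₁ (proj₂ (block-sequence a))

      position : ℕ × ℕ → ℕ
      position (a , c) = proj₁ (proj₁ (in-block a c))

      t<t⇒position≺position : ∀ p q → t p <lex t q → position p ≺[ X ] position q
      t<t⇒position≺position (a , c) (a' , d) l =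
        <lex-respʳ-≈w (proj₂ (proj₁ (in-block a' d))) (<lex-respˡ-≈w (proj₂ (proj₁ (in-block a c))) l)

      embeds : ∀ p q → p <ω² q → position p ≺[ X ] position q
      embeds (a , c) (a' , d) (inj₁ a<a') = t<t⇒position≺position (a , c) (a' , d)
        (<lex-trans (<lex-increasing V V-increasing a<a' (proj₂ (proj₂ (in-block a c))))
                    (proj₁ (proj₂ (in-block a' d))))
      embeds (a , c) (.a , d) (inj₂ (refl , c<d)) = t<t⇒position≺position (a , c) (a , d)
        (<lex-increasing (t ∘ (a ,_)) t-increasing c<d (t-increasing c))
        where
        t-increasing : ∀ c → t (a , c) <lex t (a , suc c)
        t-increasing = proj₂ (proj₂ (block-sequence a))

lemma4 : ExcludedMiddle 0ℓ →
    (b : ℕ) → 2 ≤ b → (X : Word) → IsBaseWord b X → Irrational X →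
    ((Ws : List Word) →
       ∃[ V ] (IsShiftLimitPoint X V × All (λ W → ¬ (V ≈w W)) Ws))
    × (OtIsOrdinal X → OmegaSqEmbeds X)
lemma4 lem b _ X base irr =
    InfinitelyMany-mono (λ _ → cluster-point⇒limit-point irr) (infinitely-many-cluster-points base irr)
  , λ wf → ω²-embeds irr wf base
  where open Classical lem
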